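{- There exist a constant $c>0$ and an infinite family of finite claw-free graphs $G$, with the number of vertices $n=|V(G)|$ unbounded over the family, such that $\chi_{ON}(G)\ge c\log n$ for every $G$ in the family; that is, there exist claw-free graphs $G$ on $n$ vertices with $\chi_{ON}(G)=\Omega(\log n)$.
   Context: For a graph $G$ and $v\in V(G)$, $N_G(v)$ denotes the open neighborhood of $v$. A CFON coloring of $G$ is an assignment of colors to $V(G)$ such that for every vertex $v$, some color appears exactly once among the vertices of $N_G(v)$; $\chi_{ON}(G)$ is the minimum number of colors in such a coloring. A graph is claw-free if it contains no induced subgraph isomorphic to $K_{1,3}$. -}

module Defs where

open import Data.Nat using (ℕ; _≤_; _*_; _^_)
open import Data.Fin using (Fin)
open import Data.Bool using (Bool; true; false)
open import Data.Product using (Σ; ∃; _×_)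
open import Relation.Binary.PropositionalEquality using (_≡_; _≢_)
open import Relation.Nullary using (¬_)

record Graph (n : ℕ) : Set where
  field
    adj   : Fin n → Fin n → Bool
    sym   : ∀ u v → adj u v ≡ adj v u
    irrfl : ∀ v → adj v v ≡ false
open Graph public

_∼[_]_ : ∀ {n} → Fin n → Graph n → Fin n → Set
u ∼[ G ] v = adj G u v ≡ true

HasInducedClaw : ∀ {n} → Graph n → Set
HasInducedClaw {n} G =
  Σ (Fin n) λ v → Σ (Fin n) λ a → Σ (Fin n) λ b → Σ (Fin n) λ c →
    (v ∼[ G ] a) × (v ∼[ G ] b) × (v ∼[ G ] c) ×
    (a ≢ b) × (a ≢ c) × (b ≢ c) ×
    ¬ (a ∼[ G ] b) × ¬ (a ∼[ G ] c) × ¬ (b ∼[ G ] c)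

ClawFree : ∀ {n} → Graph n → Set
ClawFree G = ¬ HasInducedClaw G

IsCFON : ∀ {n m} → Graph n → (Fin n → Fin m) → Set
IsCFON {n} G col =
  ∀ v → Σ (Fin n) λ u → (v ∼[ G ] u) ×
          (∀ w → v ∼[ G ] w → col w ≡ col u → w ≡ u)

-- G admits some CFON colouring (so χ_ON(G) is a finite number).
CFONColorable : ∀ {n} → Graph n → Set
CFONColorable {n} G = Σ ℕ λ m → Σ (Fin n → Fin m) λ col → IsCFON G col

-- χ_ON(G) ≥ (1/k)·log₂ n, i.e. every CFON colouring with m colours
-- satisfies n ≤ 2^(k·m).
χON≥log/ : ∀ {n} → Graph n → ℕ → Set
χON≥log/ {n} G k = ∀ m (col : Fin n → Fin m) → IsCFON G col → n ≤ 2 ^ (k * m)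

-- In the line graph L(K_t) the neighbourhood of the edge ab is the symmetric
-- difference of the stars at a and at b.  Given a CFON colouring with m colours,
-- record for each vertex a of K_t the parity of every colour class inside the
-- star at a.  For a ≠ b the colour of the unique-colour neighbour of ab occurs
-- exactly once in the symmetric difference of the two stars, so the two parity
-- vectors differ in that coordinate: t ≤ 2^m, hence χ_ON ≥ log₂ t ≥ ½ log₂ |V|.
-- L(K_t) is claw-free because every neighbourhood is covered by two stars,
-- which are cliques.
module Submission where

open import Algebra.Bundles using (CommutativeRing)
open import Data.Bool using (Bool; true; false; _∧_; _xor_)
open import Data.Bool.Properties using (xor-same; xor-comm; ∧-distribʳ-xor; xor-∧-commutativeRing)
open import Algebra.Properties.CommutativeSemigroup
  (CommutativeRing.+-commutativeSemigroup xor-∧-commutativeRing) using (interchange)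
open import Data.Fin using (Fin; zero; suc; _<_; combine; remQuot; finToFun; funToFin)
open import Data.Fin.Properties
  using (_≟_; _<?_; any?; suc-injective; <-irrefl; <-asym; <-cmp;
         remQuot-combine; combine-remQuot; injective⇒≤; finToFun-funToFin; 2↔Bool)
open import Data.Nat using (ℕ; zero; suc; _≤_; NonZero; _*_; _^_; _+_; z<s)
open import Data.Nat.Properties
  using (≤-trans; <-trans; m≤n+m; m≤m*n; *-mono-≤; +-identityʳ; ^-distribˡ-+-*; module ≤-Reasoning)
open import Data.Product using (Σ; _×_; _,_; proj₁; proj₂; ∃-syntax; uncurry)
open import Data.Product.Properties using (≡-dec)
open import Data.Sum using (_⊎_; inj₁; inj₂)
open import Defs hiding (sym)
open import Function using (_∘_; id)
open import Function.Bundles using (Inverse; _⇔_; mk⇔)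
open import Function.Definitions using (Injective)
open import Relation.Binary.Definitions using (DecidableEquality; tri<; tri≈; tri>)
open import Relation.Binary.PropositionalEquality
  using (_≡_; _≢_; refl; sym; trans; cong; cong₂; subst; module ≡-Reasoning)
open import Relation.Nullary using (¬_; Dec; yes; no; does; contradiction)
open import Relation.Nullary.Decidable using (_×-dec_; _⊎-dec_; ¬?; dec-true; dec-false; does-⇔)

private
  variable
    A B : Set

does-true⇒ : (a? : Dec A) → does a? ≡ true → A
does-true⇒ (yes a) _ = a

ExactlyOne : Set → Set → Set
ExactlyOne A B = (A ⊎ B) × ¬ (A × B)

exactlyOne? : Dec A → Dec B → Dec (ExactlyOne A B)
exactlyOne? a? b? = (a? ⊎-dec b?) ×-dec ¬? (a? ×-dec b?)

does-xor : (a? : Dec A) (b? : Dec B) → does a? xor does b? ≡ does (exactlyOne? a? b?)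
does-xor (yes _) (yes _) = refl
does-xor (yes _) (no _)  = refl
does-xor (no _)  (yes _) = refl
does-xor (no _)  (no _)  = refl

xor≡true⇒≢ : ∀ {x y} → x xor y ≡ true → x ≢ y
xor≡true⇒≢ {x} x⊕x≡true refl = contradiction (trans (sym x⊕x≡true) (xor-same x)) λ ()

parity : ∀ {n} → (Fin n → Bool) → Bool
parity {zero}  f = false
parity {suc n} f = f zero xor parity (f ∘ suc)

parity-xor : ∀ {n} (f g : Fin n → Bool) → parity (λ w → f w xor g w) ≡ parity f xor parity g
parity-xor {zero}  f g = refl
parity-xor {suc n} f g = trans
  (cong ((f zero xor g zero) xor_) (parity-xor (f ∘ suc) (g ∘ suc)))
  (interchange (f zero) (g zero) (parity (f ∘ suc)) (parity (g ∘ suc)))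

parity-false : ∀ {n} (f : Fin n → Bool) → (∀ w → f w ≡ false) → parity f ≡ false
parity-false {zero}  f f≡false = refl
parity-false {suc n} f f≡false =
  cong₂ _xor_ (f≡false zero) (parity-false (f ∘ suc) (f≡false ∘ suc))

parity-single : ∀ {n} (f : Fin n → Bool) (u : Fin n) →
                f u ≡ true → (∀ w → w ≢ u → f w ≡ false) → parity f ≡ true
parity-single f zero fu≡true rest =
  cong₂ _xor_ fu≡true (parity-false (f ∘ suc) (λ w → rest (suc w) λ ()))
parity-single f (suc u) fu≡true rest =
  cong₂ _xor_ (rest zero λ ())
              (parity-single (f ∘ suc) u fu≡true (λ w w≢u → rest (suc w) (w≢u ∘ suc-injective)))

separated⇒≤2^ : ∀ {t m} (φ : Fin t → Fin m → Bool) →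
                (∀ {a b} → a ≢ b → ∃[ c ] φ a c ≢ φ b c) → t ≤ 2 ^ m
separated⇒≤2^ {t} {m} φ separated = injective⇒≤ code-injective
  where
  open Inverse 2↔Bool using (to; from; strictlyInverseˡ)

  code : Fin t → Fin (2 ^ m)
  code a = funToFin (from ∘ φ a)

  decode-code : ∀ a c → to (finToFun (code a) c) ≡ φ a c
  decode-code a c = trans (cong to (finToFun-funToFin (from ∘ φ a) c)) (strictlyInverseˡ (φ a c))

  samePattern : ∀ {a b} → code a ≡ code b → ∀ c → φ a c ≡ φ b c
  samePattern {a} {b} code≡ c =
    trans (sym (decode-code a c)) (trans (cong (λ k → to (finToFun k c)) code≡) (decode-code b c))

  code-injective : Injective _≡_ _≡_ code
  code-injective {a} {b} code≡ with a ≟ b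
  ... | yes a≡b = a≡b
  ... | no a≢b  = let c , φ≢ = separated a≢b in contradiction (samePattern code≡ c) φ≢

SymmetricDifferencesAreNeighbourhoods : ∀ {n t} → Graph n → (Fin t → Fin n → Bool) → Set
SymmetricDifferencesAreNeighbourhoods {n} G S =
  ∀ {a b} → a ≢ b → ∃[ v ] ∀ w → adj G v w ≡ S a w xor S b w

cfon-≤2^ : ∀ {n t m} (G : Graph n) (S : Fin t → Fin n → Bool) →
           SymmetricDifferencesAreNeighbourhoods G S →
           (col : Fin n → Fin m) → IsCFON G col → t ≤ 2 ^ m
cfon-≤2^ {n} {t} {m} G S neighbourhood col cfon = separated⇒≤2^ φ separated
  where
  φ : Fin t → Fin m → Bool
  φ a c = parity (λ w → S a w ∧ does (col w ≟ c))

  separated : ∀ {a b} → a ≢ b → ∃[ c ] φ a c ≢ φ b c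
  separated {a} {b} a≢b with neighbourhood a≢b
  ... | v , N[v]≡ with cfon v
  ... | u , v∼u , unique = col u , xor≡true⇒≢ odd
    where
    sameColour : Fin n → Bool
    sameColour w = does (col w ≟ col u)

    restrict : ∀ w → (S a w ∧ sameColour w) xor (S b w ∧ sameColour w) ≡ adj G v w ∧ sameColour w
    restrict w = trans (sym (∧-distribʳ-xor (sameColour w) (S a w) (S b w)))
                       (cong (_∧ sameColour w) (sym (N[v]≡ w)))

    onlyAt-u : ∀ w → w ≢ u → adj G v w ∧ sameColour w ≡ false
    onlyAt-u w w≢u with adj G v w in v∼w
    ... | false = refl
    ... | true  = dec-false (col w ≟ col u) (w≢u ∘ unique w v∼w)

    odd : φ a (col u) xor φ b (col u) ≡ true
    odd = begin
      φ a (col u) xor φ b (col u)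
        ≡⟨ parity-xor (λ w → S a w ∧ sameColour w) (λ w → S b w ∧ sameColour w) ⟨
      parity (λ w → (S a w ∧ sameColour w) xor (S b w ∧ sameColour w))
        ≡⟨ parity-single _ u
             (trans (restrict u) (cong₂ _∧_ v∼u (dec-true (col u ≟ col u) refl)))
             (λ w w≢u → trans (restrict w) (onlyAt-u w w≢u)) ⟩
      true ∎
      where open ≡-Reasoning

IsClique : ∀ {n} → Graph n → (Fin n → Set) → Set
IsClique G K = ∀ {x y} → K x → K y → x ≢ y → x ∼[ G ] y

CoveredByTwoCliques : ∀ {n} → Graph n → (Fin n → Set) → Set₁
CoveredByTwoCliques {n} G X =
  Σ (Fin n → Set) λ K₁ → Σ (Fin n → Set) λ K₂ →
    (∀ w → X w → K₁ w ⊎ K₂ w) × IsClique G K₁ × IsClique G K₂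

twoCliqueNeighbourhoods⇒clawFree : ∀ {n} (G : Graph n) →
  (∀ v → CoveredByTwoCliques G (v ∼[ G ]_)) → ClawFree G
twoCliqueNeighbourhoods⇒clawFree G cover (v , a , b , c , va , vb , vc , a≢b , a≢c , b≢c , a≁b , a≁c , b≁c)
  with cover v
... | K₁ , K₂ , covers , K₁-clique , K₂-clique with covers a va | covers b vb | covers c vc
... | inj₁ a₁ | inj₁ b₁ | _       = a≁b (K₁-clique a₁ b₁ a≢b)
... | inj₂ a₂ | inj₂ b₂ | _       = a≁b (K₂-clique a₂ b₂ a≢b)
... | inj₁ a₁ | inj₂ _  | inj₁ c₁ = a≁c (K₁-clique a₁ c₁ a≢c)
... | inj₁ _  | inj₂ b₂ | inj₂ c₂ = b≁c (K₂-clique b₂ c₂ b≢c)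
... | inj₂ _  | inj₁ b₁ | inj₁ c₁ = b≁c (K₁-clique b₁ c₁ b≢c)
... | inj₂ a₂ | inj₁ _  | inj₂ c₂ = a≁c (K₂-clique a₂ c₂ a≢c)

noIsolatedVertex⇒CFONColorable : ∀ {n} (G : Graph n) → (∀ v → ∃[ u ] v ∼[ G ] u) → CFONColorable G
noIsolatedVertex⇒CFONColorable {n} G neighbour =
  n , id , λ v → proj₁ (neighbour v) , proj₂ (neighbour v) , λ w _ → id

-- A pair (i , j) with i < j is the edge ij of K_t; the remaining pairs (j ≤ i)
-- form an extra clique, which only serves to make the vertex set all of
-- Fin t × Fin t without creating isolated vertices.
Pair : ℕ → Set
Pair t = Fin t × Fin t

module _ {t : ℕ} where

  IsEdge : Pair t → Set
  IsEdge (i , j) = i < j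

  _∈ₚ_ : Fin t → Pair t → Set
  x ∈ₚ (i , j) = x ≡ i ⊎ x ≡ j

  EdgeAt : Fin t → Pair t → Set
  EdgeAt x p = IsEdge p × x ∈ₚ p

  Adjacent : Pair t → Pair t → Set
  Adjacent p q = p ≢ q × ((IsEdge p × IsEdge q × ∃[ x ] x ∈ₚ p × x ∈ₚ q) ⊎ (¬ IsEdge p × ¬ IsEdge q))

  _≟ₚ_ : DecidableEquality (Pair t)
  _≟ₚ_ = ≡-dec _≟_ _≟_

  isEdge? : ∀ p → Dec (IsEdge p)
  isEdge? (i , j) = i <? j

  _∈ₚ?_ : ∀ x p → Dec (x ∈ₚ p)
  x ∈ₚ? (i , j) = (x ≟ i) ⊎-dec (x ≟ j)

  edgeAt? : ∀ x p → Dec (EdgeAt x p)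
  edgeAt? x p = isEdge? p ×-dec (x ∈ₚ? p)

  adjacent? : ∀ p q → Dec (Adjacent p q)
  adjacent? p q = ¬? (p ≟ₚ q) ×-dec
    ((isEdge? p ×-dec isEdge? q ×-dec any? (λ x → (x ∈ₚ? p) ×-dec (x ∈ₚ? q))) ⊎-dec
     (¬? (isEdge? p) ×-dec ¬? (isEdge? q)))

  adjacent-sym : ∀ {p q} → Adjacent p q → Adjacent q p
  adjacent-sym (p≢q , inj₁ (ep , eq , x , x∈p , x∈q)) = p≢q ∘ sym , inj₁ (eq , ep , x , x∈q , x∈p)
  adjacent-sym (p≢q , inj₂ (¬ep , ¬eq))              = p≢q ∘ sym , inj₂ (¬eq , ¬ep)

  edgeAt-both : ∀ {a b q} → a < b → EdgeAt a q → EdgeAt b q → (a , b) ≡ q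
  edgeAt-both a<b (_ , inj₁ refl) (_ , inj₂ refl) = refl
  edgeAt-both a<b (_ , inj₁ refl) (_ , inj₁ refl) = contradiction a<b (<-irrefl refl)
  edgeAt-both a<b (_ , inj₂ refl) (_ , inj₂ refl) = contradiction a<b (<-irrefl refl)
  edgeAt-both a<b (k<l , inj₂ refl) (_ , inj₁ refl) = contradiction k<l (<-asym a<b)

  adjacentToEdge⇔exactlyOneEnd : ∀ {a b} q → a < b →
    Adjacent (a , b) q ⇔ ExactlyOne (EdgeAt a q) (EdgeAt b q)
  adjacentToEdge⇔exactlyOneEnd {a} {b} q a<b = mk⇔ to from
    where
    to : Adjacent (a , b) q → ExactlyOne (EdgeAt a q) (EdgeAt b q)
    to (ab≢q , inj₂ (¬ab , _)) = contradiction a<b ¬ab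
    to (ab≢q , inj₁ (_ , eq , x , inj₁ refl , x∈q)) = inj₁ (eq , x∈q) , ab≢q ∘ uncurry (edgeAt-both a<b)
    to (ab≢q , inj₁ (_ , eq , x , inj₂ refl , x∈q)) = inj₂ (eq , x∈q) , ab≢q ∘ uncurry (edgeAt-both a<b)

    ab≢q : ¬ (EdgeAt a q × EdgeAt b q) → (a , b) ≢ q
    ab≢q notBoth refl = notBoth ((a<b , inj₁ refl) , (a<b , inj₂ refl))

    from : ExactlyOne (EdgeAt a q) (EdgeAt b q) → Adjacent (a , b) q
    from (inj₁ (eq , a∈q) , notBoth) = ab≢q notBoth , inj₁ (a<b , eq , a , inj₁ refl , a∈q)
    from (inj₂ (eq , b∈q) , notBoth) = ab≢q notBoth , inj₁ (a<b , eq , b , inj₂ refl , b∈q)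

  adjacent-edge⇒edgeAtEnd : ∀ {p q} → IsEdge p → Adjacent p q → EdgeAt (proj₁ p) q ⊎ EdgeAt (proj₂ p) q
  adjacent-edge⇒edgeAtEnd ep (_ , inj₂ (¬ep , _)) = contradiction ep ¬ep
  adjacent-edge⇒edgeAtEnd ep (_ , inj₁ (_ , eq , x , inj₁ refl , x∈q)) = inj₁ (eq , x∈q)
  adjacent-edge⇒edgeAtEnd ep (_ , inj₁ (_ , eq , x , inj₂ refl , x∈q)) = inj₂ (eq , x∈q)

  adjacent-nonEdge⇒nonEdge : ∀ {p q} → ¬ IsEdge p → Adjacent p q → ¬ IsEdge q
  adjacent-nonEdge⇒nonEdge ¬ep (_ , inj₁ (ep , _)) = contradiction ep ¬ep
  adjacent-nonEdge⇒nonEdge ¬ep (_ , inj₂ (_ , ¬eq)) = ¬eq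

  edgesAt-adjacent : ∀ {x p q} → EdgeAt x p → EdgeAt x q → p ≢ q → Adjacent p q
  edgesAt-adjacent (ep , x∈p) (eq , x∈q) p≢q = p≢q , inj₁ (ep , eq , _ , x∈p , x∈q)

  nonEdges-adjacent : ∀ {p q} → ¬ IsEdge p → ¬ IsEdge q → p ≢ q → Adjacent p q
  nonEdges-adjacent ¬ep ¬eq p≢q = p≢q , inj₂ (¬ep , ¬eq)

neighbourPair : ∀ {N} (p : Pair (3 + N)) → ∃[ q ] Adjacent p q
neighbourPair p with isEdge? p
neighbourPair (suc i , j) | yes i<j =
  (zero , j) , (λ ()) , inj₁ (i<j , <-trans z<s i<j , j , inj₂ refl , inj₂ refl)
neighbourPair (zero , suc zero) | yes e =
  (zero , suc (suc zero)) , (λ ()) , inj₁ (e , z<s , zero , inj₁ refl , inj₁ refl)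
neighbourPair (zero , suc (suc j)) | yes e =
  (zero , suc zero) , (λ ()) , inj₁ (e , z<s , zero , inj₁ refl , inj₁ refl)
neighbourPair p | no ¬e with p ≟ₚ (zero , zero)
... | yes refl = (suc zero , zero) , (λ ()) , inj₂ (¬e , λ ())
... | no p≢00  = (zero , zero) , p≢00 , inj₂ (¬e , λ ())

module PaddedLineGraph (t : ℕ) where

  pairOf : Fin (t * t) → Pair t
  pairOf = remQuot t

  vertex : Pair t → Fin (t * t)
  vertex = uncurry combine

  pairOf-vertex : ∀ p → pairOf (vertex p) ≡ p
  pairOf-vertex = uncurry remQuot-combine

  pairOf-injective : Injective _≡_ _≡_ pairOf
  pairOf-injective {u} {v} pu≡pv = begin
    u                 ≡⟨ combine-remQuot {t} t u ⟨
    vertex (pairOf u) ≡⟨ cong vertex pu≡pv ⟩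
    vertex (pairOf v) ≡⟨ combine-remQuot {t} t v ⟩
    v                 ∎
    where open ≡-Reasoning

  paddedLineGraph : Graph (t * t)
  paddedLineGraph = record
    { adj   = λ u v → does (adjacent? (pairOf u) (pairOf v))
    ; sym   = λ u v → does-⇔ (mk⇔ adjacent-sym adjacent-sym)
                        (adjacent? (pairOf u) (pairOf v)) (adjacent? (pairOf v) (pairOf u))
    ; irrfl = λ v → dec-false (adjacent? (pairOf v) (pairOf v)) λ (p≢p , _) → p≢p refl
    }

  private
    G : Graph (t * t)
    G = paddedLineGraph

  ∼⇒adjacent : ∀ {u v} → u ∼[ G ] v → Adjacent (pairOf u) (pairOf v)
  ∼⇒adjacent {u} {v} = does-true⇒ (adjacent? (pairOf u) (pairOf v))

  adjacent⇒∼ : ∀ {u v} → Adjacent (pairOf u) (pairOf v) → u ∼[ G ] v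
  adjacent⇒∼ {u} {v} = dec-true (adjacent? (pairOf u) (pairOf v))

  paddedLineGraph-clawFree : ClawFree G
  paddedLineGraph-clawFree = twoCliqueNeighbourhoods⇒clawFree G cover
    where
    star : ∀ x → IsClique G (EdgeAt x ∘ pairOf)
    star x ex ey x≢y = adjacent⇒∼ (edgesAt-adjacent ex ey (x≢y ∘ pairOf-injective))

    padding : IsClique G (¬_ ∘ IsEdge ∘ pairOf)
    padding ¬ex ¬ey x≢y = adjacent⇒∼ (nonEdges-adjacent ¬ex ¬ey (x≢y ∘ pairOf-injective))

    cover : ∀ v → CoveredByTwoCliques G (v ∼[ G ]_)
    cover v with isEdge? (pairOf v)
    ... | yes e  = EdgeAt (proj₁ (pairOf v)) ∘ pairOf , EdgeAt (proj₂ (pairOf v)) ∘ pairOf ,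
                   (λ w v∼w → adjacent-edge⇒edgeAtEnd e (∼⇒adjacent v∼w)) , star _ , star _
    ... | no ¬e  = ¬_ ∘ IsEdge ∘ pairOf , ¬_ ∘ IsEdge ∘ pairOf ,
                   (λ w v∼w → inj₁ (adjacent-nonEdge⇒nonEdge ¬e (∼⇒adjacent v∼w))) , padding , padding

  paddedLineGraph-≤2^ : ∀ {m} (col : Fin (t * t) → Fin m) → IsCFON G col → t ≤ 2 ^ m
  paddedLineGraph-≤2^ = cfon-≤2^ G edgesAt symmetricDifferences
    where
    edgesAt : Fin t → Fin (t * t) → Bool
    edgesAt a w = does (edgeAt? a (pairOf w))

    neighbourhoodOfEdge : ∀ {a b} → a < b → ∀ w → adj G (vertex (a , b)) w ≡ edgesAt a w xor edgesAt b w
    neighbourhoodOfEdge {a} {b} a<b w = begin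
      does (adjacent? (pairOf (vertex (a , b))) (pairOf w))
        ≡⟨ cong (λ p → does (adjacent? p (pairOf w))) (pairOf-vertex (a , b)) ⟩
      does (adjacent? (a , b) (pairOf w))
        ≡⟨ does-⇔ (adjacentToEdge⇔exactlyOneEnd (pairOf w) a<b)
                  (adjacent? (a , b) (pairOf w)) (exactlyOne? (edgeAt? a (pairOf w)) (edgeAt? b (pairOf w))) ⟩
      does (exactlyOne? (edgeAt? a (pairOf w)) (edgeAt? b (pairOf w)))
        ≡⟨ does-xor (edgeAt? a (pairOf w)) (edgeAt? b (pairOf w)) ⟨
      edgesAt a w xor edgesAt b w ∎
      where open ≡-Reasoning

    symmetricDifferences : SymmetricDifferencesAreNeighbourhoods G edgesAt
    symmetricDifferences {a} {b} a≢b with <-cmp a b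
    ... | tri< a<b _ _ = vertex (a , b) , neighbourhoodOfEdge a<b
    ... | tri≈ _ a≡b _ = contradiction a≡b a≢b
    ... | tri> _ _ b<a = vertex (b , a) , λ w → trans (neighbourhoodOfEdge b<a w) (xor-comm (edgesAt b w) _)

open PaddedLineGraph

paddedLineGraph-colorable : ∀ N → CFONColorable (paddedLineGraph (3 + N))
paddedLineGraph-colorable N = noIsolatedVertex⇒CFONColorable (paddedLineGraph t) neighbour
  where
  t : ℕ
  t = 3 + N

  neighbour : ∀ v → ∃[ u ] v ∼[ paddedLineGraph t ] u
  neighbour v with neighbourPair (pairOf t v)
  ... | q , adjacent = vertex t q ,
    adjacent⇒∼ t {v} {vertex t q} (subst (Adjacent (pairOf t v)) (sym (pairOf-vertex t q)) adjacent)

≤2^⇒square≤2^ : ∀ {t m} → t ≤ 2 ^ m → t * t ≤ 2 ^ (2 * m)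
≤2^⇒square≤2^ {t} {m} t≤2^m = begin
  t * t              ≤⟨ *-mono-≤ t≤2^m t≤2^m ⟩
  2 ^ m * 2 ^ m      ≡⟨ cong (λ k → 2 ^ m * 2 ^ k) (+-identityʳ m) ⟨
  2 ^ m * 2 ^ (m + 0) ≡⟨ ^-distribˡ-+-* 2 m (m + 0) ⟨
  2 ^ (2 * m)        ∎
  where open ≤-Reasoning

theorem4 : Σ ℕ λ k → NonZero k ×
    ((N : ℕ) → Σ ℕ λ n → Σ (Graph n) λ G →
      (N ≤ n) × ClawFree G × CFONColorable G × χON≥log/ G k)
theorem4 = 2 , _ , λ N →
  let t = 3 + N in
  t * t , paddedLineGraph t ,
  ≤-trans (m≤n+m N 3) (m≤m*n t t) ,
  paddedLineGraph-clawFree t ,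
  paddedLineGraph-colorable N ,
  λ m col cfon → ≤2^⇒square≤2^ {m = m} (paddedLineGraph-≤2^ t col cfon)
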